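{- Let $G=(\Gamma,s)$ be a graph, let $c\in\mathrm{SR}(G)$ be a strongly recurrent configuration, and let $v\in V_M(c)$. Then $V_M(c^{v- })=\{v\}$.
   Context: A graph $G=(\Gamma,s)$ is a finite, undirected, connected multigraph (multiple edges allowed, no loops) with vertex set $V$ and distinguished sink $s$; $\tilde V:=V\setminus\{s\}$. $\mathrm{mult}(vw)$ is the number of edges between $v,w$; $\deg^A(v)=\sum_{w\in A}\mathrm{mult}(vw)$, $\deg(v)=\deg^V(v)$; $\mathbb 1_v$ is the indicator of $v$. A configuration is $c:\tilde V\to\mathbb Z$; stable if $c(v)<\deg(v)$ for all $v$. A stable $c$ is recurrent if it is a recurrent state of the Abelian sandpile Markov chain (add a grain at a random non-sink vertex, then stabilise by topplings $c\mapsto c-\deg(v)\mathbb 1_v+\sum_{w\in\tilde V}\mathrm{mult}(vw)\mathbb 1_w$ at unstable $v$); equivalently there is an ordering $v_1,\dots$ of $\tilde V$ with $c(v_i)\ge\deg^{V\setminus\{s,v_1,\dots,v_{i-1}\}}(v_i)$ for all $i$. $\mathrm{Rec}(G)$ is the set of recurrent configurations. For $c\in\mathrm{Rec}(G)$, $V_M(c):=\{v\in\tilde V:\mathrm{mult}(vs)\ge1,\ c(v)\ge\deg(v)-\mathrm{mult}(vs)\}$, and for $v\in V_M(c)$, $c^{v- }:=c-\sum_{w\in\tilde V\setminus\{v\}}\mathrm{mult}(ws)\mathbb 1_w$. A recurrent $c$ is strongly recurrent if $c^{v- }\in\mathrm{Rec}(G)$ for all $v\in V_M(c)$; $\mathrm{SR}(G)$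 is their set. -}

module Defs where

open import Data.Nat using (ℕ; zero; suc; _≥_)
open import Data.Fin using (Fin; zero; suc)
open import Data.Fin.Properties using (_≟_)
open import Data.List using (List; []; _∷_; _++_; map; allFin)
open import Data.Nat.ListAction using (sum)
open import Data.List.Relation.Binary.Permutation.Propositional using (_↭_)
open import Data.Integer using (ℤ; +_; _-_; _<_) renaming (_≥_ to _≥ℤ_)
open import Data.Product using (_×_; Σ)
open import Relation.Binary.PropositionalEquality using (_≡_; _≢_)
open import Relation.Nullary using (yes; no)

-- A graph G = (Γ, s): vertex set V = Fin (suc n), the sink s is the vertex
-- zero, the non-sink vertices Ṽ are the images suc v of v : Fin n.
-- mult u w = number of edges between u and w (a multigraph).

data Reach {m : ℕ} (mult : Fin m → Fin m → ℕ) : Fin m → Fin m → Set where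
  here : ∀ {u} → Reach mult u u
  step : ∀ {u x w} → mult u x ≥ 1 → Reach mult x w → Reach mult u w

record Graph : Set where
  field
    n         : ℕ
    mult      : Fin (suc n) → Fin (suc n) → ℕ
    mult-sym  : ∀ u w → mult u w ≡ mult w u
    no-loops  : ∀ u → mult u u ≡ 0
    connected : ∀ u w → Reach mult u w

open Graph public

sink : (G : Graph) → Fin (suc (n G))
sink G = zero

degIn : (G : Graph) → List (Fin (suc (n G))) → Fin (suc (n G)) → ℕ
degIn G A v = sum (map (mult G v) A)

deg : (G : Graph) → Fin (suc (n G)) → ℕ
deg G v = degIn G (allFin (suc (n G))) v

Config : Graph → Set
Config G = Fin (n G) → ℤ

Stable : (G : Graph) → Config G → Set
Stable G c = ∀ v → c v < + deg G (suc v)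

-- an ordering v₁,…,v_k of Ṽ (a permutation of Ṽ) such that
-- c(vᵢ) ≥ deg^{V∖{s,v₁,…,v_{i-1}}}(vᵢ); since the ordering lists Ṽ without
-- repetition, V∖{s,v₁,…,v_{i-1}} = {vᵢ,…,v_k}.
GoodOrder : (G : Graph) → Config G → List (Fin (n G)) → Set
GoodOrder G c ord =
  (ord ↭ allFin (n G)) ×
  (∀ pre x post → ord ≡ pre ++ (x ∷ post) →
     c x ≥ℤ + degIn G (map suc (x ∷ post)) (suc x))

Recurrent : (G : Graph) → Config G → Set
Recurrent G c = Stable G c × Σ (List (Fin (n G))) (GoodOrder G c)

InVM : (G : Graph) → Config G → Fin (n G) → Set
InVM G c v = (mult G (suc v) (sink G) ≥ 1)
           × (c v ≥ℤ (+ deg G (suc v) - + mult G (suc v) (sink G)))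

minusAt : (G : Graph) → Config G → Fin (n G) → Config G
minusAt G c v w with w ≟ v
... | yes _ = c w
... | no  _ = c w - + mult G (suc w) (sink G)

StronglyRecurrent : (G : Graph) → Config G → Set
StronglyRecurrent G c =
  Recurrent G c × (∀ v → InVM G c v → Recurrent G (minusAt G c v))

module Submission where

open import Defs
open import Data.Fin using (Fin; suc)
open import Data.Fin.Properties using (_≟_)
open import Data.Integer using (+_; -_; _-_; _<_)
open import Data.Integer.Properties using (+-monoˡ-<; <⇒≱)
open import Data.Product using (_,_)
open import Function.Bundles using (_⇔_; mk⇔)
open import Relation.Binary.PropositionalEquality using (_≡_; _≢_; refl; sym; subst)
open import Relation.Nullary using (¬_; yes; no; contradiction)
open import Relation.Nullary.Decidable using (decidable-stable)

-- For w ≠ v, c^{v-}(w) = c(w) - mult(ws) < deg(w) - mult(ws) by stability,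
-- so w leaves V_M; c^{v-}(v) = c(v), so v stays in V_M.

minusAt-self : (G : Graph) (c : Config G) (v : Fin (n G)) →
  minusAt G c v v ≡ c v
minusAt-self G c v with v ≟ v
... | yes _ = refl
... | no v≢v = contradiction refl v≢v

minusAt-other : (G : Graph) (c : Config G) {v w : Fin (n G)} → w ≢ v →
  minusAt G c v w ≡ c w - + mult G (suc w) (sink G)
minusAt-other G c {v} {w} w≢v with w ≟ v
... | yes w≡v = contradiction w≡v w≢v
... | no _ = refl

InVM-minusAt-self : (G : Graph) (c : Config G) (v : Fin (n G)) →
  InVM G c v → InVM G (minusAt G c v) v
InVM-minusAt-self G c v vM rewrite minusAt-self G c v = vM

Stable⇒¬InVM-minusAt-other : (G : Graph) (c : Config G) → Stable G c →
  {v w : Fin (n G)} → w ≢ v → ¬ InVM G (minusAt G c v) w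
Stable⇒¬InVM-minusAt-other G c stable {v} {w} w≢v (_ , c⁻w≥) =
  <⇒≱ (subst (_< _) (sym (minusAt-other G c w≢v))
        (+-monoˡ-< (- + mult G (suc w) (sink G)) (stable w)))
      c⁻w≥

Stable⇒InVM-minusAt⇒≡ : (G : Graph) (c : Config G) → Stable G c →
  (v w : Fin (n G)) → InVM G (minusAt G c v) w → w ≡ v
Stable⇒InVM-minusAt⇒≡ G c stable v w wM =
  decidable-stable (w ≟ v) λ w≢v → Stable⇒¬InVM-minusAt-other G c stable w≢v wM

lemma2p8 : (G : Graph) (c : Config G) → StronglyRecurrent G c →
    (v : Fin (n G)) → InVM G c v →
      (w : Fin (n G)) → InVM G (minusAt G c v) w ⇔ (w ≡ v)
lemma2p8 G c ((stable , _) , _) v vM w =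
  mk⇔ (Stable⇒InVM-minusAt⇒≡ G c stable v w) λ { refl → InVM-minusAt-self G c v vM }
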